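{- Let $W$ be Zermelo set theory $Z$ with the axiom schema of specification (separation) removed. Let ordinary capture be the schema consisting of, for every first-order formula $\alpha(x,y)$ of the language of set theory (possibly with further free variables as parameters, universally closed), the axiom $$\forall v\,\exists w\,\forall x\,\bigl(x\in w \leftrightarrow \exists y\,(y\in v \wedge \alpha(y,x) \wedge \forall z\,(\alpha(y,z)\rightarrow x=z))\bigr).$$ Then $ZF$ and $W$ + ordinary capture are the same theory, i.e. they have exactly the same theorems.
   Context: The language is first-order set theory with $\in$ and $=$. Zermelo set theory $Z$ is the theory whose axioms are extensionality, pairing, union, power set, infinity, foundation, and the specification (separation) schema; $ZF$ is $Z$ together with the replacement schema (for every formula $\phi(x,y)$, possibly with parameters: if $\phi$ is functional on a set $a$, then the image of $a$ under $\phi$ is a set). -}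

module Defs where

open import Data.Nat using (ℕ; zero; suc; _+_)
open import Data.Sum using (_⊎_)

-- First-order language of set theory with ∈ and =.
-- Terms are variables only, represented by de Bruijn indices.
infixr 4 _⇒_
infix 6 _∈'_ _≐_

data Fm : Set where
  _∈'_ : ℕ → ℕ → Fm
  _≐_  : ℕ → ℕ → Fm
  ⊥'   : Fm
  _⇒_  : Fm → Fm → Fm
  ∀'   : Fm → Fm

¬' : Fm → Fm
¬' φ = φ ⇒ ⊥'

_∨'_ : Fm → Fm → Fm
φ ∨' ψ = ¬' φ ⇒ ψ

_∧'_ : Fm → Fm → Fm
φ ∧' ψ = ¬' (φ ⇒ ¬' ψ)

_⇔_ : Fm → Fm → Fm
φ ⇔ ψ = (φ ⇒ ψ) ∧' (ψ ⇒ φ)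

∃' : Fm → Fm
∃' φ = ¬' (∀' (¬' φ))

infixr 5 _∧'_ _∨'_
infix 4 _⇔_

-- renaming (= substitution, since terms are variables)
⇑ : (ℕ → ℕ) → ℕ → ℕ
⇑ ρ zero    = zero
⇑ ρ (suc n) = suc (ρ n)

ren : (ℕ → ℕ) → Fm → Fm
ren ρ (x ∈' y) = ρ x ∈' ρ y
ren ρ (x ≐ y)  = ρ x ≐ ρ y
ren ρ ⊥'       = ⊥'
ren ρ (φ ⇒ ψ)  = ren ρ φ ⇒ ren ρ ψ
ren ρ (∀' φ)   = ∀' (ren (⇑ ρ) φ)

inst : ℕ → ℕ → ℕ
inst t zero    = t
inst t (suc n) = n

-- Hilbert-style classical first-order logic with equality over a theory T
-- (axioms may contain free variables; by Gen they act as their universal closures).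
data _⊢_ (T : Fm → Set) : Fm → Set where
  ax    : ∀ {φ} → T φ → T ⊢ φ
  K     : ∀ {φ ψ} → T ⊢ (φ ⇒ ψ ⇒ φ)
  S     : ∀ {φ ψ χ} → T ⊢ ((φ ⇒ ψ ⇒ χ) ⇒ (φ ⇒ ψ) ⇒ φ ⇒ χ)
  DNE   : ∀ {φ} → T ⊢ (¬' (¬' φ) ⇒ φ)
  MP    : ∀ {φ ψ} → T ⊢ (φ ⇒ ψ) → T ⊢ φ → T ⊢ ψ
  Gen   : ∀ {φ} → T ⊢ φ → T ⊢ ∀' φ
  ∀E    : ∀ {φ} t → T ⊢ (∀' φ ⇒ ren (inst t) φ)
  ∀D    : ∀ {φ ψ} → T ⊢ (∀' (ren suc φ ⇒ ψ) ⇒ (φ ⇒ ∀' ψ))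
  eqRefl : T ⊢ (0 ≐ 0)
  eqMemL : T ⊢ (0 ≐ 1 ⇒ 0 ∈' 2 ⇒ 1 ∈' 2)
  eqMemR : T ⊢ (0 ≐ 1 ⇒ 2 ∈' 0 ⇒ 2 ∈' 1)
  eqEq   : T ⊢ (0 ≐ 1 ⇒ 0 ≐ 2 ⇒ 1 ≐ 2)

-- Plugging a formula with designated variables into a context.
-- inst1 φ i d : variable 0 of φ ↦ i, parameter n+1 ↦ n + d (d = binder depth)
inst1 : ℕ → ℕ → ℕ → ℕ
inst1 i d zero    = i
inst1 i d (suc n) = n + d

inst2 : ℕ → ℕ → ℕ → ℕ → ℕ
inst2 i j d zero          = i
inst2 i j d (suc zero)    = j
inst2 i j d (suc (suc n)) = n + d

-- Axioms
-- ∀x∀y (∀z (z∈x ↔ z∈y) → x=y)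
Extensionality : Fm
Extensionality = ∀' (∀' (∀' (0 ∈' 2 ⇔ 0 ∈' 1) ⇒ 1 ≐ 0))

-- ∀x∀y∃p∀z (z∈p ↔ z=x ∨ z=y)
Pairing : Fm
Pairing = ∀' (∀' (∃' (∀' (0 ∈' 1 ⇔ (0 ≐ 3 ∨' 0 ≐ 2)))))

-- ∀x∃u∀z (z∈u ↔ ∃y (y∈x ∧ z∈y))
Union : Fm
Union = ∀' (∃' (∀' (0 ∈' 1 ⇔ ∃' (0 ∈' 3 ∧' 1 ∈' 0))))

-- ∀x∃p∀z (z∈p ↔ ∀y (y∈z → y∈x))
Power : Fm
Power = ∀' (∃' (∀' (0 ∈' 1 ⇔ ∀' (0 ∈' 1 ⇒ 0 ∈' 3))))

-- ∃w (∃e (∀z ¬ z∈e ∧ e∈w) ∧ ∀x (x∈w → ∃s (s∈w ∧ ∀z (z∈s ↔ z∈x ∨ z=x))))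
Infinity : Fm
Infinity = ∃' (∃' (∀' (¬' (0 ∈' 1)) ∧' 0 ∈' 1)
              ∧' ∀' (0 ∈' 1 ⇒ ∃' (0 ∈' 2 ∧' ∀' (0 ∈' 1 ⇔ (0 ∈' 2 ∨' 0 ≐ 2)))))

-- ∀x (∃y y∈x → ∃y (y∈x ∧ ∀z (z∈y → ¬ z∈x)))
Foundation : Fm
Foundation = ∀' (∃' (0 ∈' 1) ⇒ ∃' (0 ∈' 1 ∧' ∀' (0 ∈' 1 ⇒ ¬' (0 ∈' 2))))

-- Separation instance for φ(x, params) (x = variable 0 of φ):
-- ∀v∃w∀x (x∈w ↔ x∈v ∧ φ(x))
Separation : Fm → Fm
Separation φ = ∀' (∃' (∀' (0 ∈' 1 ⇔ (0 ∈' 2 ∧' ren (inst1 0 3) φ))))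

-- Replacement instance for φ(x, y, params) (x = variable 0, y = variable 1):
-- ∀a (∀x (x∈a → ∃y (φ(x,y) ∧ ∀z (φ(x,z) → z=y))) → ∃b∀y (y∈b ↔ ∃x (x∈a ∧ φ(x,y))))
Replacement : Fm → Fm
Replacement φ =
  ∀' ( ∀' (0 ∈' 1 ⇒ ∃' (ren (inst2 1 0 3) φ ∧' ∀' (ren (inst2 2 0 4) φ ⇒ 0 ≐ 1)))
     ⇒ ∃' (∀' (0 ∈' 1 ⇔ ∃' (0 ∈' 3 ∧' ren (inst2 0 1 4) φ))))

-- Ordinary capture instance for α(y, x, params) (y = variable 0, x = variable 1):
-- ∀v∃w∀x (x∈w ↔ ∃y (y∈v ∧ α(y,x) ∧ ∀z (α(y,z) → x=z)))
Capture : Fm → Fm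
Capture α =
  ∀' (∃' (∀' (0 ∈' 1 ⇔ ∃' (0 ∈' 3 ∧' ren (inst2 0 1 4) α
                                   ∧' ∀' (ren (inst2 1 0 5) α ⇒ 2 ≐ 0)))))

data WAx : Fm → Set where
  ext   : WAx Extensionality
  pair  : WAx Pairing
  union : WAx Union
  power : WAx Power
  inf   : WAx Infinity
  found : WAx Foundation

data ZAx : Fm → Set where
  w   : ∀ {φ} → WAx φ → ZAx φ
  sep : ∀ φ → ZAx (Separation φ)

data ZFAx : Fm → Set where
  z    : ∀ {φ} → ZAx φ → ZFAx φ
  repl : ∀ φ → ZFAx (Replacement φ)

data WCAx : Fm → Set where
  w    : ∀ {φ} → WAx φ → WCAx φ
  capt : ∀ α → WCAx (Capture α)

module Submission where

-- Both directions are instances of one fact about the Hilbert calculus: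
-- if every axiom of T is a theorem of U, then every theorem of T is a
-- theorem of U (lemma 'interpret').  It therefore suffices to derive
--   * every Separation instance in W + capture: capture along the graph
--     α(y,x) := y = x ∧ φ(x), whose images are the points of v satisfying φ;
--   * every Replacement instance in W + capture: capture along φ itself;
--     for φ functional on a, "φ(x,y) with y unique" is just "φ(x,y)";
--   * every Capture instance in ZF: separate the set u of those y ∈ v whose
--     α-image is unique, then replace along the functional relation
--     "x is the unique α-image of y" on u.
-- The axioms of W are shared by both theories.

open import Defs
open import Data.Product using (_×_; _,_)
open import Data.Nat using (ℕ; zero; suc; _+_)
open import Data.Nat.Properties using (+-comm)
open import Function using (_∘_; id)
open import Relation.Binary.PropositionalEquality
  using (_≡_; refl; sym; trans; cong; cong₂; _≗_)

-- Two renamings that agree pointwise act identically, and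
-- renaming twice is renaming by the composite; these two facts reduce every
-- identification of instantiated formulas to an equation between functions
-- on de Bruijn indices.

⇑-cong : ∀ {ρ σ} → ρ ≗ σ → ⇑ ρ ≗ ⇑ σ
⇑-cong h zero    = refl
⇑-cong h (suc n) = cong suc (h n)

ren-cong : ∀ {ρ σ} → ρ ≗ σ → ∀ φ → ren ρ φ ≡ ren σ φ
ren-cong h (x ∈' y) = cong₂ _∈'_ (h x) (h y)
ren-cong h (x ≐ y)  = cong₂ _≐_ (h x) (h y)
ren-cong h ⊥'       = refl
ren-cong h (φ ⇒ ψ)  = cong₂ _⇒_ (ren-cong h φ) (ren-cong h ψ)
ren-cong h (∀' φ)   = cong ∀' (ren-cong (⇑-cong h) φ)

⇑-∘ : ∀ ρ σ → ⇑ ρ ∘ ⇑ σ ≗ ⇑ (ρ ∘ σ)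
⇑-∘ ρ σ zero    = refl
⇑-∘ ρ σ (suc n) = refl

ren-∘ : ∀ ρ σ φ → ren ρ (ren σ φ) ≡ ren (ρ ∘ σ) φ
ren-∘ ρ σ (x ∈' y) = refl
ren-∘ ρ σ (x ≐ y)  = refl
ren-∘ ρ σ ⊥'       = refl
ren-∘ ρ σ (φ ⇒ ψ)  = cong₂ _⇒_ (ren-∘ ρ σ φ) (ren-∘ ρ σ ψ)
ren-∘ ρ σ (∀' φ)   = cong ∀' (trans (ren-∘ (⇑ ρ) (⇑ σ) φ) (ren-cong (⇑-∘ ρ σ) φ))

⇑-id : ∀ {ρ} → ρ ≗ id → ⇑ ρ ≗ id
⇑-id h zero    = refl
⇑-id h (suc n) = cong suc (h n)

ren-id : ∀ {ρ} → ρ ≗ id → ∀ φ → ren ρ φ ≡ φ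
ren-id h (x ∈' y) = cong₂ _∈'_ (h x) (h y)
ren-id h (x ≐ y)  = cong₂ _≐_ (h x) (h y)
ren-id h ⊥'       = refl
ren-id h (φ ⇒ ψ)  = cong₂ _⇒_ (ren-id h φ) (ren-id h ψ)
ren-id h (∀' φ)   = cong ∀' (ren-id (⇑-id h) φ)

ren-fuse : ∀ {ρ σ τ} → ρ ∘ σ ≗ τ → ∀ φ → ren ρ (ren σ φ) ≡ ren τ φ
ren-fuse h φ = trans (ren-∘ _ _ φ) (ren-cong h φ)

ren-fuse₃ : ∀ {a b c τ} → a ∘ b ∘ c ≗ τ → ∀ φ → ren a (ren b (ren c φ)) ≡ ren τ φ
ren-fuse₃ {a} {b} {c} h φ = trans (cong (ren a) (ren-∘ b c φ)) (ren-fuse h φ)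

ren-fuse₅ : ∀ {a b c d e τ} → a ∘ b ∘ c ∘ d ∘ e ≗ τ →
            ∀ φ → ren a (ren b (ren c (ren d (ren e φ)))) ≡ ren τ φ
ren-fuse₅ {a} {b} {c} {d} {e} h φ =
  trans (cong (ren a ∘ ren b) (ren-∘ c d (ren e φ)))
        (trans (cong (ren a ∘ ren b) (ren-∘ (c ∘ d) e φ)) (ren-fuse₃ h φ))

ren-cancel : ∀ {ρ σ} → ρ ∘ σ ≗ id → ∀ φ → ren ρ (ren σ φ) ≡ φ
ren-cancel h φ = trans (ren-∘ _ _ φ) (ren-id h φ)

-- Substituting the fresh variable 0 after shifting is the identity; this is
-- what lets a universally quantified hypothesis be used at its own bound
-- variable.
inst0∘⇑suc : inst 0 ∘ ⇑ suc ≗ id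
inst0∘⇑suc zero    = refl
inst0∘⇑suc (suc n) = refl

shift-depth : (g : ℕ → ℕ) (d₀ d : ℕ) → (∀ m → g (d₀ + m) ≡ d + m) →
              ∀ n → g (n + d₀) ≡ n + d
shift-depth g d₀ d h n = trans (cong g (+-comm n d₀)) (trans (h n) (+-comm d n))

inst1-post : ∀ (g : ℕ → ℕ) i₀ d₀ i d → g i₀ ≡ i → (∀ m → g (d₀ + m) ≡ d + m) →
             g ∘ inst1 i₀ d₀ ≗ inst1 i d
inst1-post g i₀ d₀ i d p h zero    = p
inst1-post g i₀ d₀ i d p h (suc n) = shift-depth g d₀ d h n

inst2-post : ∀ (g : ℕ → ℕ) i₀ j₀ d₀ i j d → g i₀ ≡ i → g j₀ ≡ j →
             (∀ m → g (d₀ + m) ≡ d + m) → g ∘ inst2 i₀ j₀ d₀ ≗ inst2 i j d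
inst2-post g i₀ j₀ d₀ i j d p q h zero          = p
inst2-post g i₀ j₀ d₀ i j d p q h (suc zero)    = q
inst2-post g i₀ j₀ d₀ i j d p q h (suc (suc n)) = shift-depth g d₀ d h n

interpret : ∀ {T U : Fm → Set} → (∀ {φ} → T φ → U ⊢ φ) → ∀ {φ} → T ⊢ φ → U ⊢ φ
interpret f (ax a)   = f a
interpret f K        = K
interpret f S        = S
interpret f DNE      = DNE
interpret f (MP p q) = MP (interpret f p) (interpret f q)
interpret f (Gen p)  = Gen (interpret f p)
interpret f (∀E t)   = ∀E t
interpret f ∀D       = ∀D
interpret f eqRefl   = eqRefl
interpret f eqMemL   = eqMemL
interpret f eqMemR   = eqMemR
interpret f eqEq     = eqEq

-- A judgement Γ ⊩ A means
-- that the Hilbert calculus proves the curried implication Γ ⇛ A; the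
-- deduction theorem then makes the usual introduction and elimination rules
-- derivable, which is how all object-level derivations below are written.
module NaturalDeduction (T : Fm → Set) where

  variable
    A B C : Fm

  identity : T ⊢ (A ⇒ A)
  identity {A} = MP (MP (S {ψ = A ⇒ A}) K) K

  compose : T ⊢ (A ⇒ B) → T ⊢ (B ⇒ C) → T ⊢ (A ⇒ C)
  compose f g = MP (MP S (MP K g)) f

  infixl 4 _,,_
  data Ctx : Set where
    ε    : Ctx
    _,,_ : Ctx → Fm → Ctx

  _⇛_ : Ctx → Fm → Fm
  ε ⇛ φ        = φ
  (Γ ,, γ) ⇛ φ = Γ ⇛ (γ ⇒ φ)

  infix 2 _⊩_
  record _⊩_ (Γ : Ctx) (φ : Fm) : Set where
    constructor ⟨_⟩
    field un : T ⊢ (Γ ⇛ φ)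
  open _⊩_ public

  variable
    Γ : Ctx

  lift₁ : ∀ Γ → T ⊢ (A ⇒ B) → T ⊢ ((Γ ⇛ A) ⇒ (Γ ⇛ B))
  lift₁ ε h        = h
  lift₁ (Γ ,, γ) h = lift₁ Γ (MP S (MP K h))

  lift₂ : ∀ Γ → T ⊢ (A ⇒ B ⇒ C) → T ⊢ ((Γ ⇛ A) ⇒ (Γ ⇛ B) ⇒ (Γ ⇛ C))
  lift₂ ε h        = h
  lift₂ (Γ ,, γ) h = lift₂ Γ (compose (MP S (MP K h)) S)

  theorem : T ⊢ A → Γ ⊩ A
  theorem {Γ = ε} p      = ⟨ p ⟩
  theorem {Γ = Γ ,, γ} p = ⟨ un (theorem {Γ = Γ} (MP K p)) ⟩

  closed : ε ⊩ A → T ⊢ A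
  closed p = un p

  hyp : Γ ,, A ⊩ A
  hyp {Γ} = ⟨ un (theorem {Γ = Γ} identity) ⟩

  wk : Γ ⊩ A → Γ ,, B ⊩ A
  wk {Γ} p = ⟨ MP (lift₁ Γ K) (un p) ⟩

  hyp₁ : Γ ,, A ,, B ⊩ A
  hyp₁ = wk hyp

  hyp₂ : Γ ,, A ,, B ,, C ⊩ A
  hyp₂ = wk hyp₁

  lam : Γ ,, A ⊩ B → Γ ⊩ A ⇒ B
  lam p = ⟨ un p ⟩

  app : Γ ⊩ A ⇒ B → Γ ⊩ A → Γ ⊩ B
  app {Γ} p q = ⟨ MP (MP (lift₂ Γ identity) (un p)) (un q) ⟩

  wk-under : Γ ,, A ⊩ B → Γ ,, C ,, A ⊩ B
  wk-under q = app (wk (wk (lam q))) hyp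

  cast : A ≡ B → Γ ⊩ A → Γ ⊩ B
  cast refl p = p

  raa : Γ ,, ¬' A ⊩ ⊥' → Γ ⊩ A
  raa p = app (theorem DNE) (lam p)

  efq : Γ ⊩ ⊥' → Γ ⊩ A
  efq p = raa (wk p)

  andI : Γ ⊩ A → Γ ⊩ B → Γ ⊩ A ∧' B
  andI p q = lam (app (app hyp (wk p)) (wk q))

  andE₁ : Γ ⊩ A ∧' B → Γ ⊩ A
  andE₁ p = raa (app (wk p) (lam (efq (app hyp₁ hyp))))

  andE₂ : Γ ⊩ A ∧' B → Γ ⊩ B
  andE₂ p = raa (app (wk p) (lam hyp₁))

  ⇔-rewriteʳ : ∀ {P Q Q'} → Γ ⊩ (P ⇔ Q) → Γ ⊩ Q ⇒ Q' → Γ ⊩ Q' ⇒ Q → Γ ⊩ P ⇔ Q'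
  ⇔-rewriteʳ p f g = andI (lam (app (wk f) (app (andE₁ (wk p)) hyp)))
                          (lam (app (andE₂ (wk p)) (app (wk g) hyp)))

  -- Going under a binder shifts every hypothesis.
  ↑ : Ctx → Ctx
  ↑ ε        = ε
  ↑ (Γ ,, γ) = ↑ Γ ,, ren suc γ

  ∀-distrib : ∀ Γ φ → T ⊢ (∀' (↑ Γ ⇛ φ) ⇒ (Γ ⇛ ∀' φ))
  ∀-distrib ε φ        = identity
  ∀-distrib (Γ ,, γ) φ = compose (∀-distrib Γ (ren suc γ ⇒ φ)) (lift₁ Γ ∀D)

  allI : ↑ Γ ⊩ A → Γ ⊩ ∀' A
  allI {Γ} {A} p = ⟨ MP (∀-distrib Γ A) (Gen (un p)) ⟩

  allE : ∀ t → Γ ⊩ ∀' A → Γ ⊩ ren (inst t) A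
  allE t p = app (theorem (∀E t)) p

  exI : ∀ t → Γ ⊩ ren (inst t) A → Γ ⊩ ∃' A
  exI t p = lam (app (allE t hyp) (wk p))

  exE : Γ ⊩ ∃' A → ↑ Γ ,, A ⊩ ren suc C → Γ ⊩ C
  exE p q = raa (app (wk p) (allI (lam (app (wk hyp) (app (wk (wk (lam q))) hyp)))))

  ∀-map : Γ ⊩ ∀' A → ↑ Γ ,, A ⊩ B → Γ ⊩ ∀' B
  ∀-map {A = A} p q =
    app (lam (allI (app (wk (lam q)) (cast (ren-cancel inst0∘⇑suc A) (allE 0 hyp))))) p

  ∃-map : Γ ⊩ ∃' A → ↑ Γ ,, A ⊩ B → Γ ⊩ ∃' B
  ∃-map {B = B} p q = exE p (exI 0 (cast (sym (ren-cancel inst0∘⇑suc B)) q))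

  ∀-mono : T ⊢ (A ⇒ B) → T ⊢ (∀' A ⇒ ∀' B)
  ∀-mono h = closed (lam (∀-map hyp (app (theorem h) hyp)))

  ∃-mono : T ⊢ (A ⇒ B) → T ⊢ (∃' A ⇒ ∃' B)
  ∃-mono h = closed (lam (∃-map hyp (app (theorem h) hyp)))

  -- The equality axioms are stated for variables 0,1,2; instantiating their
  -- universal closure gives them at arbitrary variables.
  instantiate₃ : ∀ {E} a b c → T ⊢ E →
                 T ⊢ ren (inst a) (ren (⇑ (inst b)) (ren (⇑ (⇑ (inst c))) E))
  instantiate₃ a b c p = MP (∀E a) (MP (∀E b) (MP (∀E c) (Gen (Gen (Gen p)))))

  ≐-refl : ∀ a → T ⊢ (a ≐ a)
  ≐-refl a = MP (∀E a) (Gen eqRefl)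

  ≐-∈ˡ : ∀ a b c → T ⊢ (a ≐ b ⇒ a ∈' c ⇒ b ∈' c)
  ≐-∈ˡ a b c = instantiate₃ a b c eqMemL

  ≐-euclid : ∀ a b c → T ⊢ (a ≐ b ⇒ a ≐ c ⇒ b ≐ c)
  ≐-euclid a b c = instantiate₃ a b c eqEq

  ≐-sym : ∀ a b → T ⊢ (a ≐ b ⇒ b ≐ a)
  ≐-sym a b = closed (lam (app (app (theorem (≐-euclid a b a)) hyp) (theorem (≐-refl a))))

-- Separation from capture.  For φ(x) take α(y,x) := y = x ∧ φ(x).  Every y
-- has at most one α-image, namely y itself when φ(y), so the capture set of v
-- along α is {x ∈ v | φ(x)}.
module SeparationFromCapture (φ : Fm) where
  open NaturalDeduction WCAx

  graph : Fm
  graph = (0 ≐ 1) ∧' ren (inst1 1 2) φ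

  -- Matrices of the two set descriptions, with x = 0, w = 1, v = 2 and the
  -- parameters of φ from 3 on.
  captured : Fm
  captured = ∃' (0 ∈' 3 ∧' ren (inst2 0 1 4) graph ∧' ∀' (ren (inst2 1 0 5) graph ⇒ 2 ≐ 0))

  separated : Fm
  separated = 0 ∈' 2 ∧' ren (inst1 0 3) φ

  -- φ(x) as it occurs inside α(y,x) under the binder ∃y.
  φ-in-graph : ren (inst2 0 1 4) (ren (inst1 1 2) φ) ≡ ren (inst1 1 4) φ
  φ-in-graph = ren-fuse (inst1-post (inst2 0 1 4) 1 2 1 4 refl (λ m → +-comm m 4)) φ

  φ-shifted : ren suc (ren (inst1 0 3) φ) ≡ ren (inst1 1 4) φ
  φ-shifted = ren-fuse (inst1-post suc 0 3 1 4 refl (λ m → refl)) φ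

  φ-at-x : ren (inst 0) (ren (inst1 1 4) φ) ≡ ren (inst1 0 3) φ
  φ-at-x = ren-fuse (inst1-post (inst 0) 1 4 0 3 refl (λ m → refl)) φ

  -- A witness y with y ∈ v and y = x gives x ∈ v, and φ(x) is part of α(y,x).
  captured⇒separated : ε ,, captured ⊩ separated
  captured⇒separated =
    exE hyp (andI (app (app (theorem (≐-∈ˡ 0 1 3)) (andE₁ (andE₁ (andE₂ hyp)))) (andE₁ hyp))
                  (cast (trans φ-in-graph (sym φ-shifted)) (andE₂ (andE₁ (andE₂ hyp)))))

  -- Conversely x itself is the witness; uniqueness of the image is the first
  -- conjunct of α.
  separated⇒captured : ε ,, separated ⊩ captured
  separated⇒captured =
    exI 0 (andI (andE₁ hyp)
                (andI (andI (theorem (≐-refl 0))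
                            (cast (sym (trans (cong (ren (inst 0)) φ-in-graph) φ-at-x)) (andE₂ hyp)))
                      (theorem (Gen (closed (lam (andE₁ hyp)))))))

  separation : WCAx ⊢ Separation φ
  separation =
    MP (∀-mono (∃-mono (∀-mono (closed (lam
         (⇔-rewriteʳ hyp (lam (wk-under captured⇒separated)) (lam (wk-under separated⇒captured))))))))
       (ax (capt graph))

-- Capture along φ itself: the capture set of a is
-- {y | ∃x ∈ a. φ(x,y) ∧ y is the only φ-image of x}.  When φ is functional on
-- a, the uniqueness clause is automatic, so this set is the image of a.
module ReplacementFromCapture (φ : Fm) where
  open NaturalDeduction WCAx

  -- φ is functional on a (a = 0; inside: x = 0, a = 1).
  functional : Fm
  functional = ∀' (0 ∈' 1 ⇒ ∃' (ren (inst2 1 0 3) φ ∧' ∀' (ren (inst2 2 0 4) φ ⇒ 0 ≐ 1)))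

  -- Membership conditions with y = 0, b = 1, a = 2.
  captured : Fm
  captured = 0 ∈' 1 ⇔ ∃' (0 ∈' 3 ∧' ren (inst2 0 1 4) φ ∧' ∀' (ren (inst2 1 0 5) φ ⇒ 2 ≐ 0))

  image : Fm
  image = 0 ∈' 1 ⇔ ∃' (0 ∈' 3 ∧' ren (inst2 0 1 4) φ)

  -- The functionality hypothesis instantiated at x, seen under the binders
  -- y, b, x.
  functional-at-x :
    ren (⇑ (inst 0)) (ren (⇑ (⇑ suc)) (ren (⇑ (⇑ suc)) (ren (⇑ (⇑ suc))
      (ren (inst2 1 0 3) φ ∧' ∀' (ren (inst2 2 0 4) φ ⇒ 0 ≐ 1)))))
    ≡ (ren (inst2 1 0 5) φ ∧' ∀' (ren (inst2 2 0 6) φ ⇒ 0 ≐ 1))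
  functional-at-x =
    cong₂ _∧'_
      (ren-fuse₅ (inst2-post (λ k → ⇑ (inst 0) (⇑ (⇑ suc) (⇑ (⇑ suc) (⇑ (⇑ suc) k))))
                             1 0 3 1 0 5 refl refl (λ m → refl)) φ)
      (cong (λ X → ∀' (X ⇒ 0 ≐ 1))
            (ren-fuse₅ (inst2-post (λ k → ⇑ (⇑ (inst 0)) (⇑ (⇑ (⇑ suc)) (⇑ (⇑ (⇑ suc)) (⇑ (⇑ (⇑ suc)) k))))
                                   2 0 4 2 0 6 refl refl (λ m → refl)) φ))

  -- If x ∈ a, φ(x,y), and y' is the unique φ-image of x, then every φ-image
  -- z of x equals y: both y and z equal y'.
  image-unique :
    ∀ {Δ} → Δ ,, ren suc (0 ∈' 3 ∧' ren (inst2 0 1 4) φ)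
              ,, (ren (inst2 1 0 5) φ ∧' ∀' (ren (inst2 2 0 6) φ ⇒ 0 ≐ 1))
          ⊩ ren suc (∀' (ren (inst2 1 0 5) φ ⇒ 2 ≐ 0))
  image-unique =
    allI (lam (app (app (theorem (≐-euclid 1 3 0))
                        (app (theorem (≐-sym 3 1))                         -- y = y'
                             (app (allE 3 (andE₂ hyp₁)) (cast y-image (andE₂ hyp₂)))))
                   (app (theorem (≐-sym 0 1))                              -- z = y'
                        (app (allE 0 (andE₂ hyp₁)) (cast z-image hyp)))))
    where
    -- φ(x,z) and φ(x,y), rewritten as instances of the uniqueness clause of y'.
    z-image : ren (⇑ suc) (ren (inst2 1 0 5) φ) ≡ ren (inst 0) (ren (⇑ suc) (ren (inst2 2 0 6) φ))
    z-image = trans (ren-fuse (inst2-post (⇑ suc) 1 0 5 2 0 6 refl refl (λ m → refl)) φ)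
                    (sym (ren-fuse₃ (inst2-post (λ k → inst 0 (⇑ suc k)) 2 0 6 2 0 6 refl refl (λ m → refl)) φ))
    y-image : ren suc (ren suc (ren (inst2 0 1 4) φ)) ≡ ren (inst 3) (ren (⇑ suc) (ren (inst2 2 0 6) φ))
    y-image = trans (ren-fuse₃ (inst2-post (λ k → suc (suc k)) 0 1 4 2 3 6 refl refl (λ m → refl)) φ)
                    (sym (ren-fuse₃ (inst2-post (λ k → inst 3 (⇑ suc k)) 2 0 6 2 3 6 refl refl (λ m → refl)) φ))

  captured⇔image : ∀ {Δ} → Δ ,, ren suc (ren suc functional) ,, ren suc (∀' captured) ,, captured ⊩ image
  captured⇔image =
    ⇔-rewriteʳ hyp
      (lam (∃-map hyp (andI (andE₁ hyp) (andE₁ (andE₂ hyp)))))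
      (lam (∃-map hyp (andI (andE₁ hyp) (andI (andE₂ hyp)
         (exE (app (allE 0 (wk (wk (wk (wk hyp))))) (andE₁ hyp))
              (app (wk (lam image-unique)) (cast functional-at-x hyp)))))))

  replacement : WCAx ⊢ Replacement φ
  replacement = MP (∀-mono (closed (lam (lam (∃-map hyp₁ (∀-map hyp captured⇔image))))))
                   (ax (capt φ))

-- Given α(y,x) and v, let ψ(y) say that y has exactly one
-- α-image and χ(y,x) say that x is that image.  Separation gives
-- u = {y ∈ v | ψ(y)}; χ is functional on u, so Replacement gives
-- b = {x | ∃y ∈ u. χ(y,x)}, which is precisely the capture set of v along α.
module CaptureFromZF (α : Fm) where
  open NaturalDeduction ZFAx

  cong₄ : ∀ (f : Fm → Fm → Fm → Fm → Fm) {a b c d a' b' c' d'} →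
          a ≡ a' → b ≡ b' → c ≡ c' → d ≡ d' → f a b c d ≡ f a' b' c' d'
  cong₄ f refl refl refl refl = refl

  -- ψ(y), with y = 0.
  hasUniqueImage : Fm
  hasUniqueImage = ∃' (ren (inst2 1 0 2) α ∧' ∀' (ren (inst2 2 0 3) α ⇒ 1 ≐ 0))

  -- χ(y,x), with y = 0 and x = 1.
  uniqueImage : Fm
  uniqueImage = α ∧' ∀' (ren (inst2 1 0 3) α ⇒ 2 ≐ 0)

  -- Membership conditions for u = 1 over v = 2 (element 0), for the capture
  -- set 1 of v = 2, and for the replacement set 1 of u = 2.
  separated : Fm
  separated = 0 ∈' 1 ⇔ (0 ∈' 2 ∧' ren (inst1 0 3) hasUniqueImage)

  captured : Fm
  captured = 0 ∈' 1 ⇔ ∃' (0 ∈' 3 ∧' ren (inst2 0 1 4) α ∧' ∀' (ren (inst2 1 0 5) α ⇒ 2 ≐ 0))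

  replaced : Fm
  replaced = 0 ∈' 1 ⇔ ∃' (0 ∈' 3 ∧' ren (inst2 0 1 4) uniqueImage)

  -- Functionality of χ on u = 0 (the hypothesis of Replacement for χ).
  functional : Fm
  functional = ∀' (0 ∈' 1 ⇒ ∃' (ren (inst2 1 0 3) uniqueImage ∧' ∀' (ren (inst2 2 0 4) uniqueImage ⇒ 0 ≐ 1)))

  -- Shapes of the formulas above once all renamings are pushed into α; the
  -- lemmas '…-unfolded' and '…-of-witness' identify them with the formulas
  -- produced by instantiation.
  ExistsUnique : Fm → Fm → Fm
  ExistsUnique A A' = ∃' (A ∧' ∀' (A' ⇒ 1 ≐ 0))

  Functional : Fm → Fm → Fm → Fm → Fm
  Functional A₁ A₂ A₃ A₄ =
    ∀' (0 ∈' 1 ⇒ ∃' ((A₁ ∧' ∀' (A₂ ⇒ 1 ≐ 0)) ∧' ∀' ((A₃ ∧' ∀' (A₄ ⇒ 1 ≐ 0)) ⇒ 0 ≐ 1)))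

  Collects : ℕ → Fm → Fm → Fm
  Collects k A A' = 0 ∈' 1 ⇔ ∃' (0 ∈' k ∧' (A ∧' ∀' (A' ⇒ 2 ≐ 0)))

  hasUniqueImage-at-depth : ∀ d →
    ren (inst1 0 d) hasUniqueImage ≡ ExistsUnique (ren (inst2 1 0 (suc d)) α) (ren (inst2 2 0 (suc (suc d))) α)
  hasUniqueImage-at-depth d =
    cong₂ ExistsUnique
      (ren-fuse (inst2-post (⇑ (inst1 0 d)) 1 0 2 1 0 (suc d) refl refl (λ m → cong suc (+-comm m d))) α)
      (ren-fuse (inst2-post (⇑ (⇑ (inst1 0 d))) 2 0 3 2 0 (suc (suc d)) refl refl
                            (λ m → cong (suc ∘ suc) (+-comm m d))) α)

  functional-unfolded : ren (⇑ suc) functional ≡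
    Functional (ren (inst2 1 0 4) α) (ren (inst2 2 0 5) α) (ren (inst2 2 0 5) α) (ren (inst2 3 0 6) α)
  functional-unfolded =
    cong₄ Functional
      (ren-fuse (inst2-post (⇑ (⇑ (⇑ suc))) 1 0 3 1 0 4 refl refl (λ m → refl)) α)
      (ren-fuse₃ (inst2-post (λ k → ⇑ (⇑ (⇑ (⇑ suc))) (⇑ (inst2 1 0 3) k)) 1 0 3 2 0 5 refl refl
                             (λ m → cong (λ k → ⇑ (⇑ (⇑ (⇑ suc))) (suc k)) (+-comm m 3))) α)
      (ren-fuse (inst2-post (⇑ (⇑ (⇑ (⇑ suc)))) 2 0 4 2 0 5 refl refl (λ m → refl)) α)
      (ren-fuse₃ (inst2-post (λ k → ⇑ (⇑ (⇑ (⇑ (⇑ suc)))) (⇑ (inst2 2 0 4) k)) 1 0 3 3 0 6 refl refl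
                             (λ m → cong (λ k → ⇑ (⇑ (⇑ (⇑ (⇑ suc)))) (suc k)) (+-comm m 4))) α)

  replaced-unfolded : ren (⇑ (⇑ (⇑ suc))) replaced ≡ Collects 3 (ren (inst2 0 1 5) α) (ren (inst2 1 0 6) α)
  replaced-unfolded =
    cong₂ (Collects 3)
      (ren-fuse (inst2-post (⇑ (⇑ (⇑ (⇑ suc)))) 0 1 4 0 1 5 refl refl (λ m → refl)) α)
      (ren-fuse₃ (inst2-post (λ k → ⇑ (⇑ (⇑ (⇑ (⇑ suc)))) (⇑ (inst2 0 1 4) k)) 1 0 3 1 0 6 refl refl
                             (λ m → cong (λ k → ⇑ (⇑ (⇑ (⇑ (⇑ suc)))) (suc k)) (+-comm m 4))) α)

  captured-unfolded : ren (⇑ (⇑ suc)) captured ≡ Collects 4 (ren (inst2 0 1 5) α) (ren (inst2 1 0 6) α)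
  captured-unfolded =
    cong₂ (Collects 4)
      (ren-fuse (inst2-post (⇑ (⇑ (⇑ suc))) 0 1 4 0 1 5 refl refl (λ m → refl)) α)
      (ren-fuse (inst2-post (⇑ (⇑ (⇑ (⇑ suc)))) 1 0 5 1 0 6 refl refl (λ m → refl)) α)

  -- On u, χ is functional: an element y of u satisfies ψ(y), i.e. has an
  -- α-image x which is unique, and any x' with χ(y,x') equals x.
  functional-on-separated : ∀ {Γ} → Γ ,, ∀' separated ⊩
    Functional (ren (inst2 1 0 4) α) (ren (inst2 2 0 5) α) (ren (inst2 2 0 5) α) (ren (inst2 3 0 6) α)
  functional-on-separated =
    allI (lam (∃-map (cast (hasUniqueImage-at-depth 3)
                           (andE₂ (app (andE₁ (cast (ren-cancel inst0∘⇑suc separated) (allE 0 hyp₁))) hyp)))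
                     (andI hyp (allI (lam
                       (app (theorem (≐-sym 1 0))
                            (app (allE 0 (andE₂ hyp₁))
                                 (cast (sym (ren-cancel inst0∘⇑suc (ren (inst2 2 0 5) α))) (andE₁ hyp)))))))))

  -- A witness y ∈ u with χ(y,x) has ψ(y), witnessed by x itself.
  hasUniqueImage-of-witness :
    ren (inst 0) (ren (⇑ suc) (ren (⇑ suc) (ren (⇑ suc) (ren (inst1 0 3) hasUniqueImage))))
    ≡ ExistsUnique (ren (inst2 1 0 6) α) (ren (inst2 2 0 7) α)
  hasUniqueImage-of-witness =
    trans (ren-fuse₅ (inst1-post (λ k → inst 0 (⇑ suc (⇑ suc (⇑ suc k)))) 0 3 0 5 refl (λ m → refl))
                     hasUniqueImage)
          (hasUniqueImage-at-depth 5)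

  uniqueImage-of-witness :
    (ren (inst2 0 1 5) α ∧' ∀' (ren (inst2 1 0 6) α ⇒ 2 ≐ 0))
    ≡ (ren (inst 1) (ren (inst2 1 0 6) α) ∧' ∀' (ren (⇑ (inst 1)) (ren (inst2 2 0 7) α) ⇒ 2 ≐ 0))
  uniqueImage-of-witness =
    cong₂ (λ A B → A ∧' ∀' (B ⇒ 2 ≐ 0))
      (sym (ren-fuse (inst2-post (inst 1) 1 0 6 0 1 5 refl refl (λ m → refl)) α))
      (sym (ren-fuse (inst2-post (⇑ (inst 1)) 2 0 7 1 0 6 refl refl (λ m → refl)) α))

  -- The replacement set of u along χ and the capture set of v along α have
  -- the same members: y ∈ u is y ∈ v together with ψ(y), and ψ(y) follows
  -- from χ(y,x).
  replaced⇔captured : ∀ {Δ X} → Δ ,, ren suc (ren suc (∀' separated)) ,, X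
                        ,, Collects 3 (ren (inst2 0 1 5) α) (ren (inst2 1 0 6) α)
                      ⊩ Collects 4 (ren (inst2 0 1 5) α) (ren (inst2 1 0 6) α)
  replaced⇔captured =
    ⇔-rewriteʳ hyp
      (lam (∃-map hyp (andI (andE₁ (app (andE₁ (allE 0 (wk (wk (wk (wk hyp)))))) (andE₁ hyp)))
                            (andE₂ hyp))))
      (lam (∃-map hyp (andI (app (andE₂ (allE 0 (wk (wk (wk (wk hyp))))))
                                 (andI (andE₁ hyp)
                                       (cast (sym hasUniqueImage-of-witness)
                                             (exI 1 (cast uniqueImage-of-witness (andE₂ hyp))))))
                            (andE₂ hyp))))

  -- Instantiating Replacement at u, which is bound one level further out.
  inst0∘⇑suc∘⇑suc : inst 0 ∘ ⇑ suc ∘ ⇑ suc ≗ ⇑ suc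
  inst0∘⇑suc∘⇑suc zero    = refl
  inst0∘⇑suc∘⇑suc (suc n) = refl

  -- For each v: separate u from v, apply Replacement to u, and recognise the
  -- resulting set as the capture set.
  capture-from-instances : ZFAx ⊢ (Separation hasUniqueImage ⇒ Replacement uniqueImage ⇒ Capture α)
  capture-from-instances =
    closed (lam (lam (∀-map hyp₁ (exE hyp
      (∃-map (app (cast (ren-fuse₃ inst0∘⇑suc∘⇑suc (functional ⇒ ∃' (∀' replaced))) (allE 0 hyp₂))
                  (cast (sym functional-unfolded) functional-on-separated))
             (∀-map hyp (cast (sym captured-unfolded)
                              (app (wk (lam replaced⇔captured)) (cast replaced-unfolded hyp)))))))))

  capture : ZFAx ⊢ Capture α
  capture = MP (MP capture-from-instances (ax (z (sep hasUniqueImage)))) (ax (repl uniqueImage))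

zf-axiom-in-wc : ∀ {φ} → ZFAx φ → WCAx ⊢ φ
zf-axiom-in-wc (z (w a))   = ax (w a)
zf-axiom-in-wc (z (sep φ)) = SeparationFromCapture.separation φ
zf-axiom-in-wc (repl φ)    = ReplacementFromCapture.replacement φ

wc-axiom-in-zf : ∀ {φ} → WCAx φ → ZFAx ⊢ φ
wc-axiom-in-zf (w a)    = ax (z (w a))
wc-axiom-in-zf (capt α) = CaptureFromZF.capture α

mainTheorem1 : (φ : Fm) → ((ZFAx ⊢ φ → WCAx ⊢ φ) × (WCAx ⊢ φ → ZFAx ⊢ φ))
mainTheorem1 φ = interpret zf-axiom-in-wc , interpret wc-axiom-in-zf
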